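{- Let $(X_a,\prec_a)$ be finitely many finite partially ordered sets, $X$ their disjoint union (elements written $(a,i)$ with $i\in X_a$), and let $(X,A)$ be a graph with vertex set $X$ whose set of connected components $\mathcal{C}(X,A)$ satisfies: (1) every $Q\in\mathcal{C}(X,A)$ is a complete subgraph of $(X,A)$; (2) if $(a,i)\in Q$ and $(a,j)\in Q$ then $i=j$. Define the relation $\dot\prec$ on $\mathcal{C}(X,A)$ by $P\dot\prec Q$ whenever there exist $(a,i)\in P$ and $(a,j)\in Q$ with $(a,i)\prec_a(a,j)$, and let $\prec$ be the transitive closure of $\dot\prec$. Assume that whenever $P\prec Q$, $(a,i)\in P$ and $(a,j)\in Q$, we have $(a,i)\prec_a(a,j)$. Then $\prec$ is a (strict) partial order on $\mathcal{C}(X,A)$.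
   Context: Partial orders are taken as strict orders (irreflexive, transitive). Elements of the $a$-th poset $X_a$ are denoted $(a,i)$. -}

module Defs where

open import Data.Nat using (ℕ)
open import Data.Fin using (Fin)
open import Data.Product using (Σ; ∃; _×_; _,_)
open import Relation.Binary using (Rel; Symmetric; IsStrictPartialOrder)
open import Relation.Binary.PropositionalEquality using (_≡_; _≢_)
open import Relation.Binary.Construct.Closure.ReflexiveTransitive using (Star)
open import Relation.Binary.Construct.Closure.Transitive using (TransClosure)

record FinPosets : Set₁ where
  field
    m   : ℕ
    n   : Fin m → ℕ
    lt  : (a : Fin m) → Rel (Fin (n a)) Agda.Primitive.lzero
    isSPO : (a : Fin m) → IsStrictPartialOrder _≡_ (lt a)

X : FinPosets → Set
X P = Σ (Fin (FinPosets.m P)) (λ a → Fin (FinPosets.n P a))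

record Graph (V : Set) : Set₁ where
  field
    Adj : Rel V Agda.Primitive.lzero
    sym : Symmetric Adj

SameComp : ∀ {V} → Graph V → Rel V _
SameComp G = Star (Graph.Adj G)

module _ (P : FinPosets) (G : Graph (X P)) where
  open FinPosets P

  ComponentsComplete : Set
  ComponentsComplete = ∀ x y → SameComp G x y → x ≢ y → Graph.Adj G x y

  ComponentsTransversal : Set
  ComponentsTransversal = ∀ a i j → SameComp G (a , i) (a , j) → i ≡ j

  -- The relation ≺̇ on components, via representatives:
  -- P ≺̇ Q iff ∃ (a,i) ∈ P, (a,j) ∈ Q with i ≺_a j.
  DotPrec : Rel (X P) _
  DotPrec x y = ∃ λ a → ∃ λ i → ∃ λ j →
    SameComp G x (a , i) × SameComp G y (a , j) × lt a i j

  Prec : Rel (X P) _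
  Prec = TransClosure DotPrec

  PrecCompatible : Set
  PrecCompatible = ∀ x y a i j → Prec x y →
    SameComp G x (a , i) → SameComp G y (a , j) → lt a i j

-- Transitivity is built into the closure, and ≺̇ is defined through
-- representatives, so ≺ respects the component relation.  Irreflexivity is
-- where compatibility enters: P ≺ P with (a , i) ∈ P would give i ≺_a i.
module Submission where

open import Data.Product using (_,_)
open import Relation.Nullary using (¬_)
open import Relation.Binary using (Rel; IsEquivalence; IsStrictPartialOrder; Symmetric; _Respects₂_; _Respectsˡ_; _Respectsʳ_)
open import Relation.Binary.PropositionalEquality using (refl)
open import Relation.Binary.Construct.Closure.ReflexiveTransitive using (ε; _◅◅_; reverse)
open import Relation.Binary.Construct.Closure.Transitive using (TransClosure; [_]; _∷_; _++_)

open import Defs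

module _ {a ℓ₁ ℓ₂} {A : Set a} {_≈_ : Rel A ℓ₁} {_∼_ : Rel A ℓ₂} where

  TransClosure-respectsʳ : _∼_ Respectsʳ _≈_ → TransClosure _∼_ Respectsʳ _≈_
  TransClosure-respectsʳ resp y≈z [ x∼y ]      = [ resp y≈z x∼y ]
  TransClosure-respectsʳ resp y≈z (x∼w ∷ w∼⁺y) = x∼w ∷ TransClosure-respectsʳ resp y≈z w∼⁺y

  TransClosure-respectsˡ : _∼_ Respectsˡ _≈_ → TransClosure _∼_ Respectsˡ _≈_
  TransClosure-respectsˡ resp x≈z [ x∼y ]      = [ resp x≈z x∼y ]
  TransClosure-respectsˡ resp x≈z (x∼w ∷ w∼⁺y) = resp x≈z x∼w ∷ w∼⁺y

  TransClosure-respects₂ : _∼_ Respects₂ _≈_ → TransClosure _∼_ Respects₂ _≈_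
  TransClosure-respects₂ (respʳ , respˡ) =
    TransClosure-respectsʳ respʳ , TransClosure-respectsˡ respˡ

module _ {V : Set} (G : Graph V) where

  SameComp-sym : Symmetric (SameComp G)
  SameComp-sym = reverse (Graph.sym G)

  SameComp-isEquivalence : IsEquivalence (SameComp G)
  SameComp-isEquivalence = record { refl = ε ; sym = SameComp-sym ; trans = _◅◅_ }

module _ (P : FinPosets) (G : Graph (X P)) where

  DotPrec-respects₂ : DotPrec P G Respects₂ SameComp G
  DotPrec-respects₂ =
    (λ y≈z (a , i , j , x≈ai , y≈aj , i<j) →
       a , i , j , x≈ai , SameComp-sym G y≈z ◅◅ y≈aj , i<j) ,
    (λ x≈z (a , i , j , x≈ai , y≈aj , i<j) →
       a , i , j , SameComp-sym G x≈z ◅◅ x≈ai , y≈aj , i<j)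

  Prec-irrefl : PrecCompatible P G → ∀ {x y} → SameComp G x y → ¬ Prec P G x y
  Prec-irrefl compat {a , i} {y} x≈y x≺y =
    IsStrictPartialOrder.irrefl (FinPosets.isSPO P a) refl
      (compat (a , i) y a i i x≺y ε (SameComp-sym G x≈y))

lemma2p4 : (P : FinPosets) (G : Graph (X P)) →
    ComponentsComplete P G → ComponentsTransversal P G → PrecCompatible P G →
    IsStrictPartialOrder (SameComp G) (Prec P G)
lemma2p4 P G _ _ compat = record
  { isEquivalence = SameComp-isEquivalence G
  ; irrefl        = Prec-irrefl P G compat
  ; trans         = _++_
  ; <-resp-≈      = TransClosure-respects₂ (DotPrec-respects₂ P G)
  }
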